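{- Let $R$ be a nonzero commutative ring with identity and $n\ge1$. The kernel of the group homomorphism $Sym^n:\mathrm{GL}_2(R)\to\mathrm{GL}_{n+1}(R)$ is $$\mathrm{Ker}(Sym^n)=\{\lambda I_2:\lambda\in R,\ \lambda^n=1\},$$ where $I_2$ is the $2\times2$ identity matrix.
   Context: Let $M$ be a free $R$-module with basis $\{e_1,e_2\}$ and $\mathcal{T}^n(M)=M^{\otimes n}$, on which $S_n$ acts by permuting tensor factors; $\mathcal{S}^n(M)$ is the submodule of $S_n$-invariant tensors. For $1\le i\le n+1$ let $u_i$ be the sum of all $e_{j_1}\otimes\cdots\otimes e_{j_n}$ over all sequences $(j_1,\dots,j_n)\in\{1,2\}^n$ with exactly $n-i+1$ entries equal to $1$ and $i-1$ equal to $2$; $\{u_1,\dots,u_{n+1}\}$ is an $R$-basis of $\mathcal{S}^n(M)$. An automorphism $E$ of $M$ induces $E^{\otimes n}$ on $\mathcal{T}^n(M)$, which restricts to an automorphism $E_{\mathcal{S}^n}$ of $\mathcal{S}^n(M)$. $Sym^n$ sends the matrix of $E$ in the basis $\{e_1,e_2\}$ to the matrix of $E_{\mathcal{S}^n}$ in the basis $\{u_1,\dots,u_{n+1}\}$. -}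

module Defs where

open import Level using (Level)
open import Data.Nat as ℕ using (ℕ; zero; suc)
open import Data.Fin using (Fin; zero; suc; toℕ)
open import Data.Bool using (Bool; true; false; if_then_else_)
open import Data.Product using (Σ; ∃; _×_; _,_)
open import Algebra.Bundles using (CommutativeRing)

module SymPower {c ℓ : Level} (R : CommutativeRing c ℓ) where
  open CommutativeRing R using (_≈_; _+_; _*_; 0#; 1#) renaming (Carrier to A)

  -- matrices as functions: M i j = entry in row i, column j (0-based)
  Mat : ℕ → ℕ → Set c
  Mat m k = Fin m → Fin k → A

  ∑ : (k : ℕ) → (Fin k → A) → A
  ∑ zero    f = 0#
  ∑ (suc k) f = f zero + ∑ k (λ i → f (suc i))

  ∏ : (k : ℕ) → (Fin k → A) → A
  ∏ zero    f = 1#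
  ∏ (suc k) f = f zero * ∏ k (λ i → f (suc i))

  _⊗_ : ∀ {m k p} → Mat m k → Mat k p → Mat m p
  _⊗_ {k = k} M N i j = ∑ k (λ l → M i l * N l j)

  I : (m : ℕ) → Mat m m
  I m i j = if toℕ i ℕ.≡ᵇ toℕ j then 1# else 0#

  scal : ∀ {m k} → A → Mat m k → Mat m k
  scal λ′ M i j = λ′ * M i j

  _≋_ : ∀ {m k} → Mat m k → Mat m k → Set ℓ
  M ≋ N = ∀ i j → M i j ≈ N i j

  IsInvertible : ∀ {m} → Mat m m → Set (c Level.⊔ ℓ)
  IsInvertible {m} E = Σ (Mat m m) λ F → (E ⊗ F) ≋ I m × (F ⊗ E) ≋ I m

  pow : A → ℕ → A
  pow x zero    = 1#
  pow x (suc n) = x * pow x n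

  -- Tensor power T^n(M) of M = R e₁ ⊕ R e₂, in coordinates w.r.t. the basis
  -- e_{s 0} ⊗ … ⊗ e_{s (n-1)}, indexed by sequences s : Fin n → Fin 2
  -- (zero ↔ e₁, suc zero ↔ e₂).
  Seq : ℕ → Set
  Seq n = Fin n → Fin 2

  cons : ∀ {n} → Fin 2 → Seq n → Seq (suc n)
  cons b s zero    = b
  cons b s (suc k) = s k

  ∑seq : (n : ℕ) → (Seq n → A) → A
  ∑seq zero    f = f (λ ())
  ∑seq (suc n) f = ∑seq n (λ s → f (cons zero s)) + ∑seq n (λ s → f (cons (suc zero) s))

  Tensor : ℕ → Set c
  Tensor n = Seq n → A

  -- E^{⊗n} acting on coordinates; E is the matrix of an endomorphism of M
  -- (column j = coordinates of E e_j)
  tensorPow : (n : ℕ) → Mat 2 2 → Tensor n → Tensor n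
  tensorPow n E v s = ∑seq n (λ t → ∏ n (λ k → E (s k) (t k)) * v t)

  twos : ∀ {n} → Seq n → ℕ
  twos {zero}  s = zero
  twos {suc n} s with s zero
  ... | zero  = twos (λ k → s (suc k))
  ... | suc _ = suc (twos (λ k → s (suc k)))

  -- u_{i+1} (0-based index i = number of e₂-factors): the sum of all basis
  -- tensors with exactly n-i factors e₁ and i factors e₂
  u : (n : ℕ) → Fin (suc n) → Tensor n
  u n i s = if twos s ℕ.≡ᵇ toℕ i then 1# else 0#

  rep : (n : ℕ) → Fin (suc n) → Seq n
  rep n i k = if toℕ k ℕ.+ toℕ i ℕ.<ᵇ n then zero else suc zero

  -- Sym^n E : the matrix of E^{⊗n} restricted to S^n(M) in the basis u.
  -- Since E^{⊗n} u_j is S_n-invariant, it equals Σ_i c_i u_i where c_i is its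
  -- coordinate at any sequence with exactly i entries e₂; we read it off at rep n i.
  Sym : (n : ℕ) → Mat 2 2 → Mat (suc n) (suc n)
  Sym n E i j = tensorPow n E (u n j) (rep n i)

{-# OPTIONS --safe #-}
module Submission where

-- The (i, j) entry of Symⁿ E, for E = [[a, b], [c, d]], is the coefficient of Xʲ in
-- (a + b X)ⁿ⁻ⁱ (c + d X)ⁱ.  Column 0 therefore reads aⁿ⁻ⁱ cⁱ and column n reads
-- bⁿ⁻ⁱ dⁱ.  If Symⁿ E = I, rows 0 and 1 of column 0 give aⁿ = 1 and aⁿ⁻¹ c = 0, so c = 0;
-- rows n and n - 1 of column n give likewise b = 0; for diagonal E the (1, 1) entry is
-- aⁿ⁻¹ d = 1, which forces d = a.  Conversely t I₂ multiplies every basis tensor by tⁿ.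

open import Defs
open import Level using (Level)
open import Data.Nat using (ℕ; suc; _≥_)
open import Data.Product using (Σ; _×_)
open import Relation.Nullary using (¬_)
open import Function.Bundles using (_⇔_)
open import Algebra.Bundles using (CommutativeRing)

open import Data.Bool using (true; false; if_then_else_; T)
open import Data.Nat as ℕ using (zero; _∸_; _≤_; _<_; z≤n; s≤s)
open import Data.Nat.Properties
  using (≤-refl; ≤-trans; ≤-antisym; ≰⇒>; <⇒≱; m≤n+m; m≤n⇒m≤1+n; 1+n≢n; n∸n≡0; +-∸-assoc; m+n∸n≡m;
         ≡⇒≡ᵇ; ≡ᵇ⇒≡; <⇒<ᵇ; <ᵇ⇒<; _≤?_)
open import Data.Fin using (Fin; zero; suc; toℕ; fromℕ; inject₁)
open import Data.Fin.Properties using (toℕ-fromℕ; toℕ-inject₁; toℕ≤pred[n])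
open import Data.Product using (_,_)
open import Data.Empty using (⊥-elim)
open import Function using (_∘_)
open import Function.Bundles using (mk⇔)
open import Relation.Nullary using (yes; no)
open import Relation.Binary.PropositionalEquality as ≡ using (_≡_; _≢_; _≗_)

private
  variable
    ℓ : Level
    B : Set ℓ

pattern one = suc zero

if-true : ∀ {b} {x y : B} → T b → (if b then x else y) ≡ x
if-true {b = true} _ = ≡.refl

if-false : ∀ {b} {x y : B} → ¬ T b → (if b then x else y) ≡ y
if-false {b = true}  ¬T = ⊥-elim (¬T _)
if-false {b = false} _  = ≡.refl

module _ {ℓ₁ ℓ₂ : Level} (R : CommutativeRing ℓ₁ ℓ₂) where
  open CommutativeRing R hiding (zero) renaming (Carrier to A)
  open SymPower R
  open import Relation.Binary.Reasoning.Setoid setoid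

  ∑seq-cong : ∀ n {f g : Seq n → A} → (∀ t → f t ≈ g t) → ∑seq n f ≈ ∑seq n g
  ∑seq-cong zero    f≈g = f≈g _
  ∑seq-cong (suc n) f≈g = +-cong (∑seq-cong n (f≈g ∘ _)) (∑seq-cong n (f≈g ∘ _))

  *-distribˡ-∑seq : ∀ n x (f : Seq n → A) → ∑seq n (λ t → x * f t) ≈ x * ∑seq n f
  *-distribˡ-∑seq zero    x f = refl
  *-distribˡ-∑seq (suc n) x f = begin
    ∑seq n (λ t → x * f (cons zero t)) + ∑seq n (λ t → x * f (cons one t))
      ≈⟨ +-cong (*-distribˡ-∑seq n x _) (*-distribˡ-∑seq n x _) ⟩
    x * ∑seq n (f ∘ cons zero) + x * ∑seq n (f ∘ cons one)
      ≈⟨ distribˡ x _ _ ⟨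
    x * ∑seq (suc n) f ∎

  ∑seq-zero : ∀ n → ∑seq n (λ _ → 0#) ≈ 0#
  ∑seq-zero zero    = refl
  ∑seq-zero (suc n) = trans (+-cong (∑seq-zero n) (∑seq-zero n)) (+-identityʳ 0#)

  ∏-cong : ∀ n {f g : Fin n → A} → (∀ k → f k ≈ g k) → ∏ n f ≈ ∏ n g
  ∏-cong zero    f≈g = refl
  ∏-cong (suc n) f≈g = *-cong (f≈g zero) (∏-cong n (f≈g ∘ suc))

  ∏-const : ∀ n x → ∏ n (λ _ → x) ≡ pow x n
  ∏-const zero    x = ≡.refl
  ∏-const (suc n) x = ≡.cong (x *_) (∏-const n x)

  -- linearProduct n f j is the coefficient of Xʲ in ∏ₖ (f k zero + f k one · X).
  linearProduct : (n : ℕ) → (Fin n → Fin 2 → A) → ℕ → A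
  linearProduct zero    f zero    = 1#
  linearProduct zero    f (suc j) = 0#
  linearProduct (suc n) f zero    = f zero zero * linearProduct n (f ∘ suc) zero
  linearProduct (suc n) f (suc j) =
    f zero zero * linearProduct n (f ∘ suc) (suc j) + f zero one * linearProduct n (f ∘ suc) j

  ∑seq-factorˡ : ∀ n x (g h : Seq n → A) → ∑seq n (λ t → (x * g t) * h t) ≈ x * ∑seq n (λ t → g t * h t)
  ∑seq-factorˡ n x g h = trans (∑seq-cong n (λ t → *-assoc x (g t) (h t))) (*-distribˡ-∑seq n x _)

  ∑seq-expansion : ∀ n (f : Fin n → Fin 2 → A) j →
    ∑seq n (λ t → ∏ n (λ k → f k (t k)) * (if twos t ℕ.≡ᵇ j then 1# else 0#)) ≈ linearProduct n f j
  ∑seq-expansion zero    f zero    = *-identityˡ 1#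
  ∑seq-expansion zero    f (suc j) = *-identityˡ 0#
  ∑seq-expansion (suc n) f zero =
    trans (+-cong (trans (∑seq-factorˡ n _ _ _) (*-congˡ (∑seq-expansion n (f ∘ suc) zero)))
                  (trans (∑seq-cong n (λ t → zeroʳ _)) (∑seq-zero n)))
          (+-identityʳ _)
  ∑seq-expansion (suc n) f (suc j) =
    +-cong (trans (∑seq-factorˡ n _ _ _) (*-congˡ (∑seq-expansion n (f ∘ suc) (suc j))))
           (trans (∑seq-factorˡ n _ _ _) (*-congˡ (∑seq-expansion n (f ∘ suc) j)))

  linearProduct-constant : ∀ n (f : Fin n → Fin 2 → A) → linearProduct n f 0 ≈ ∏ n (λ k → f k zero)
  linearProduct-constant zero    f = refl
  linearProduct-constant (suc n) f = *-congˡ (linearProduct-constant n (f ∘ suc))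

  linearProduct-vanishing : ∀ n (f : Fin n → Fin 2 → A) {j} → n < j → linearProduct n f j ≈ 0#
  linearProduct-vanishing zero    f {suc j} _         = refl
  linearProduct-vanishing (suc n) f {suc j} (s≤s n<j) = begin
    f zero zero * linearProduct n (f ∘ suc) (suc j) + f zero one * linearProduct n (f ∘ suc) j
      ≈⟨ +-cong (*-congˡ (linearProduct-vanishing n (f ∘ suc) (m≤n⇒m≤1+n n<j)))
                (*-congˡ (linearProduct-vanishing n (f ∘ suc) n<j)) ⟩
    f zero zero * 0# + f zero one * 0#  ≈⟨ +-cong (zeroʳ _) (zeroʳ _) ⟩
    0# + 0#                             ≈⟨ +-identityʳ 0# ⟩
    0#                                  ∎

  linearProduct-leading : ∀ n (f : Fin n → Fin 2 → A) → linearProduct n f n ≈ ∏ n (λ k → f k one)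
  linearProduct-leading zero    f = refl
  linearProduct-leading (suc n) f = begin
    f zero zero * linearProduct n (f ∘ suc) (suc n) + f zero one * linearProduct n (f ∘ suc) n
      ≈⟨ +-cong (*-congˡ (linearProduct-vanishing n (f ∘ suc) ≤-refl))
                (*-congˡ (linearProduct-leading n (f ∘ suc))) ⟩
    f zero zero * 0# + f zero one * ∏ n (λ k → f (suc k) one)  ≈⟨ +-congʳ (zeroʳ _) ⟩
    0# + ∏ (suc n) (λ k → f k one)                             ≈⟨ +-identityˡ _ ⟩
    ∏ (suc n) (λ k → f k one)                                  ∎

  IsDiagonal : Mat 2 2 → Set ℓ₂
  IsDiagonal E = E zero one ≈ 0# × E one zero ≈ 0#

  *-if : ∀ b x y → x * (if b then y else 0#) ≈ (if b then x * y else 0#)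
  *-if true  x y = refl
  *-if false x y = zeroʳ x

  linearProduct-diagonal : ∀ E → IsDiagonal E → ∀ n (s : Seq n) j →
    linearProduct n (E ∘ s) j ≈ (if twos s ℕ.≡ᵇ j then ∏ n (λ k → E (s k) (s k)) else 0#)
  linearProduct-diagonal E diag zero    s zero    = refl
  linearProduct-diagonal E diag zero    s (suc j) = refl
  linearProduct-diagonal E diag@(b≈0 , c≈0) (suc n) s zero with s zero
  ... | zero     = trans (*-congˡ (linearProduct-diagonal E diag n (s ∘ suc) zero)) (*-if _ _ _)
  ... | one      = trans (*-congʳ c≈0) (zeroˡ _)
  linearProduct-diagonal E diag@(b≈0 , c≈0) (suc n) s (suc j) with s zero
  ... | zero     =
    trans (+-cong (*-congˡ (linearProduct-diagonal E diag n (s ∘ suc) (suc j))) (*-congʳ b≈0))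
          (trans (+-cong (*-if _ _ _) (zeroˡ _)) (+-identityʳ _))
  ... | one      =
    trans (+-cong (*-congʳ c≈0) (*-congˡ (linearProduct-diagonal E diag n (s ∘ suc) j)))
          (trans (+-cong (zeroˡ _) (*-if _ _ _)) (+-identityˡ _))

  twos-cong : ∀ {n} {s s′ : Seq n} → s ≗ s′ → twos s ≡ twos s′
  twos-cong {zero}          s≗s′ = ≡.refl
  twos-cong {suc n} {s} {s′} s≗s′ with s zero | s′ zero | s≗s′ zero
  ... | zero     | _ | ≡.refl = twos-cong (s≗s′ ∘ suc)
  ... | one      | _ | ≡.refl = ≡.cong suc (twos-cong (s≗s′ ∘ suc))

  twos-allTwos : ∀ n → twos {n} (λ _ → one) ≡ n
  twos-allTwos zero    = ≡.refl
  twos-allTwos (suc n) = ≡.cong suc (twos-allTwos n)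

  repℕ : (n : ℕ) → ℕ → Seq n
  repℕ n m k = if toℕ k ℕ.+ m ℕ.<ᵇ n then zero else one

  repℕ-head : ∀ {n m} → m ≤ n → repℕ (suc n) m ≗ cons zero (repℕ n m)
  repℕ-head m≤n zero    = if-true (<⇒<ᵇ (s≤s m≤n))
  repℕ-head m≤n (suc k) = ≡.refl

  repℕ-allTwos : ∀ {n m} → n ≤ m → repℕ n m ≗ λ _ → one
  repℕ-allTwos {n} {m} n≤m k = if-false (λ k+m<n → <⇒≱ (<ᵇ⇒< _ n k+m<n) (≤-trans n≤m (m≤n+m m (toℕ k))))

  twos-repℕ : ∀ n {m} → m ≤ n → twos (repℕ n m) ≡ m
  twos-repℕ zero    z≤n = ≡.refl
  twos-repℕ (suc n) {m} m≤1+n with m ≤? n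
  ... | yes m≤n = ≡.trans (twos-cong (repℕ-head m≤n)) (twos-repℕ n m≤n)
  ... | no  m≰n with ≤-antisym m≤1+n (≰⇒> m≰n)
  ...   | ≡.refl = ≡.trans (twos-cong (repℕ-allTwos {suc n} ≤-refl)) (twos-allTwos (suc n))

  ∏-repℕ : ∀ (g : Fin 2 → A) n {m} → m ≤ n → ∏ n (g ∘ repℕ n m) ≈ pow (g zero) (n ∸ m) * pow (g one) m
  ∏-repℕ g zero    z≤n = sym (*-identityˡ 1#)
  ∏-repℕ g (suc n) {m} m≤1+n with m ≤? n
  ... | yes m≤n = begin
    ∏ (suc n) (g ∘ repℕ (suc n) m)               ≈⟨ ∏-cong (suc n) (reflexive ∘ ≡.cong g ∘ repℕ-head m≤n) ⟩
    g zero * ∏ n (g ∘ repℕ n m)                  ≈⟨ *-congˡ (∏-repℕ g n m≤n) ⟩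
    g zero * (pow (g zero) (n ∸ m) * pow (g one) m) ≈⟨ *-assoc _ _ _ ⟨
    pow (g zero) (suc (n ∸ m)) * pow (g one) m   ≡⟨ ≡.cong (λ e → pow (g zero) e * pow (g one) m) (+-∸-assoc 1 m≤n) ⟨
    pow (g zero) (suc n ∸ m) * pow (g one) m     ∎
  ... | no  m≰n with ≤-antisym m≤1+n (≰⇒> m≰n)
  ...   | ≡.refl = begin
    ∏ (suc n) (g ∘ repℕ (suc n) (suc n))         ≈⟨ ∏-cong (suc n) (reflexive ∘ ≡.cong g ∘ repℕ-allTwos {suc n} ≤-refl) ⟩
    ∏ (suc n) (λ _ → g one)                      ≡⟨ ∏-const (suc n) (g one) ⟩
    pow (g one) (suc n)                          ≈⟨ *-identityˡ _ ⟨
    pow (g zero) 0 * pow (g one) (suc n)         ≡⟨ ≡.cong (λ e → pow (g zero) e * pow (g one) (suc n)) (n∸n≡0 n) ⟨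
    pow (g zero) (suc n ∸ suc n) * pow (g one) (suc n) ∎

  Sym-entry : ∀ n E (i j : Fin (suc n)) → Sym n E i j ≈ linearProduct n (E ∘ rep n i) (toℕ j)
  Sym-entry n E i j = ∑seq-expansion n (E ∘ rep n i) (toℕ j)

  Sym-firstColumn : ∀ n E (i : Fin (suc n)) →
    Sym n E i zero ≈ pow (E zero zero) (n ∸ toℕ i) * pow (E one zero) (toℕ i)
  Sym-firstColumn n E i = begin
    Sym n E i zero                         ≈⟨ Sym-entry n E i zero ⟩
    linearProduct n (E ∘ rep n i) 0        ≈⟨ linearProduct-constant n (E ∘ rep n i) ⟩
    ∏ n (λ k → E (rep n i k) zero)         ≈⟨ ∏-repℕ (λ x → E x zero) n (toℕ≤pred[n] i) ⟩
    pow (E zero zero) (n ∸ toℕ i) * pow (E one zero) (toℕ i) ∎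

  Sym-lastColumn : ∀ n E (i : Fin (suc n)) →
    Sym n E i (fromℕ n) ≈ pow (E zero one) (n ∸ toℕ i) * pow (E one one) (toℕ i)
  Sym-lastColumn n E i = begin
    Sym n E i (fromℕ n)                            ≈⟨ Sym-entry n E i (fromℕ n) ⟩
    linearProduct n (E ∘ rep n i) (toℕ (fromℕ n))  ≡⟨ ≡.cong (linearProduct n (E ∘ rep n i)) (toℕ-fromℕ n) ⟩
    linearProduct n (E ∘ rep n i) n                ≈⟨ linearProduct-leading n (E ∘ rep n i) ⟩
    ∏ n (λ k → E (rep n i k) one)                  ≈⟨ ∏-repℕ (λ x → E x one) n (toℕ≤pred[n] i) ⟩
    pow (E zero one) (n ∸ toℕ i) * pow (E one one) (toℕ i) ∎

  Sym-diagonal : ∀ n E → IsDiagonal E → (i j : Fin (suc n)) →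
    Sym n E i j ≈ (if toℕ i ℕ.≡ᵇ toℕ j then ∏ n (λ k → E (rep n i k) (rep n i k)) else 0#)
  Sym-diagonal n E diag i j = begin
    Sym n E i j                                    ≈⟨ Sym-entry n E i j ⟩
    linearProduct n (E ∘ rep n i) (toℕ j)          ≈⟨ linearProduct-diagonal E diag n (rep n i) (toℕ j) ⟩
    (if twos (rep n i) ℕ.≡ᵇ toℕ j then P else 0#)  ≡⟨ ≡.cong (λ w → if w ℕ.≡ᵇ toℕ j then P else 0#) (twos-repℕ n (toℕ≤pred[n] i)) ⟩
    (if toℕ i ℕ.≡ᵇ toℕ j then P else 0#)           ∎
    where P = ∏ n (λ k → E (rep n i k) (rep n i k))

  I-diagonal : ∀ m (i : Fin m) → I m i i ≡ 1#
  I-diagonal m i = if-true (≡⇒≡ᵇ (toℕ i) (toℕ i) ≡.refl)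

  I-offDiagonal : ∀ m (i j : Fin m) → toℕ i ≢ toℕ j → I m i j ≡ 0#
  I-offDiagonal m i j i≢j = if-false (i≢j ∘ ≡ᵇ⇒≡ (toℕ i) (toℕ j))

  x*y≈1⇒y*z≈w⇒z≈x*w : ∀ {x y z w} → x * y ≈ 1# → y * z ≈ w → z ≈ x * w
  x*y≈1⇒y*z≈w⇒z≈x*w {x} {y} {z} {w} x*y≈1 y*z≈w = begin
    z            ≈⟨ *-identityˡ z ⟨
    1# * z       ≈⟨ *-congʳ x*y≈1 ⟨
    (x * y) * z  ≈⟨ *-assoc x y z ⟩
    x * (y * z)  ≈⟨ *-congˡ y*z≈w ⟩
    x * w        ∎

  scalar⇒kernel : ∀ n E t → pow t n ≈ 1# → E ≋ scal t (I 2) → Sym n E ≋ I (suc n)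
  scalar⇒kernel n E t tⁿ≈1 E≋tI i j =
    trans (Sym-diagonal n E diag i j) (if-then-cong (toℕ i ℕ.≡ᵇ toℕ j) diagonalProduct≈1)
    where
    diag : IsDiagonal E
    diag = trans (E≋tI zero one) (zeroʳ t) , trans (E≋tI one zero) (zeroʳ t)

    E-diagonal : ∀ x → E x x ≈ t
    E-diagonal zero = trans (E≋tI zero zero) (*-identityʳ t)
    E-diagonal one  = trans (E≋tI one one) (*-identityʳ t)

    diagonalProduct≈1 : ∏ n (λ k → E (rep n i k) (rep n i k)) ≈ 1#
    diagonalProduct≈1 = trans (∏-cong n (E-diagonal ∘ rep n i)) (trans (reflexive (∏-const n t)) tⁿ≈1)

    if-then-cong : ∀ b {x y z} → x ≈ y → (if b then x else z) ≈ (if b then y else z)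
    if-then-cong true  x≈y = x≈y
    if-then-cong false _   = refl

  module Kernel (m : ℕ) (E : Mat 2 2) (Sym≋I : Sym (suc m) E ≋ I (suc (suc m))) where
    n : ℕ
    n = suc m

    a b c d : A
    a = E zero zero
    b = E zero one
    c = E one zero
    d = E one one

    a*aᵐ≈1 : a * pow a m ≈ 1#
    a*aᵐ≈1 = trans (sym (*-identityʳ _)) (trans (sym (Sym-firstColumn n E zero)) (Sym≋I zero zero))

    aᵐ*c≈0 : pow a m * (c * 1#) ≈ 0#
    aᵐ*c≈0 = trans (sym (Sym-firstColumn n E one)) (Sym≋I one zero)

    c≈0 : c ≈ 0#
    c≈0 = trans (sym (*-identityʳ c)) (trans (x*y≈1⇒y*z≈w⇒z≈x*w a*aᵐ≈1 aᵐ*c≈0) (zeroʳ a))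

    lastColumn : ∀ (i : Fin (suc n)) {k} → toℕ i ≡ k → Sym n E i (fromℕ n) ≈ pow b (n ∸ k) * pow d k
    lastColumn i ≡.refl = Sym-lastColumn n E i

    d*dᵐ≈1 : d * pow d m ≈ 1#
    d*dᵐ≈1 = begin
      d * pow d m                ≈⟨ *-identityˡ _ ⟨
      pow b 0 * pow d n          ≡⟨ ≡.cong (λ e → pow b e * pow d n) (n∸n≡0 n) ⟨
      pow b (n ∸ n) * pow d n    ≈⟨ lastColumn (fromℕ n) (toℕ-fromℕ n) ⟨
      Sym n E (fromℕ n) (fromℕ n) ≈⟨ Sym≋I (fromℕ n) (fromℕ n) ⟩
      I (suc n) (fromℕ n) (fromℕ n) ≡⟨ I-diagonal (suc n) (fromℕ n) ⟩
      1#                         ∎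

    penultimate : Fin (suc n)
    penultimate = inject₁ (fromℕ m)

    toℕ-penultimate : toℕ penultimate ≡ m
    toℕ-penultimate = ≡.trans (toℕ-inject₁ (fromℕ m)) (toℕ-fromℕ m)

    dᵐ*b≈0 : pow d m * (b * 1#) ≈ 0#
    dᵐ*b≈0 = begin
      pow d m * (b * 1#)         ≈⟨ *-comm _ _ ⟩
      pow b 1 * pow d m          ≡⟨ ≡.cong (λ e → pow b e * pow d m) (m+n∸n≡m 1 m) ⟨
      pow b (n ∸ m) * pow d m    ≈⟨ lastColumn penultimate toℕ-penultimate ⟨
      Sym n E penultimate (fromℕ n) ≈⟨ Sym≋I penultimate (fromℕ n) ⟩
      I (suc n) penultimate (fromℕ n) ≡⟨ I-offDiagonal (suc n) penultimate (fromℕ n) penultimate≢last ⟩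
      0#                         ∎
      where
      penultimate≢last : toℕ penultimate ≢ toℕ (fromℕ n)
      penultimate≢last eq = 1+n≢n (≡.trans (≡.sym (≡.trans eq (≡.cong suc (toℕ-fromℕ m)))) toℕ-penultimate)

    b≈0 : b ≈ 0#
    b≈0 = trans (sym (*-identityʳ b)) (trans (x*y≈1⇒y*z≈w⇒z≈x*w d*dᵐ≈1 dᵐ*b≈0) (zeroʳ d))

    aᵐ*d≈1 : pow a m * (d * 1#) ≈ 1#
    aᵐ*d≈1 = begin
      pow a m * (d * 1#)                         ≈⟨ ∏-repℕ (λ x → E x x) n (s≤s z≤n) ⟨
      ∏ n (λ k → E (rep n one k) (rep n one k))  ≈⟨ Sym-diagonal n E (b≈0 , c≈0) one one ⟨
      Sym n E one one                            ≈⟨ Sym≋I one one ⟩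
      1#                                         ∎

    a≈d : a ≈ d
    a≈d = trans (sym (*-identityʳ a)) (trans (sym (x*y≈1⇒y*z≈w⇒z≈x*w a*aᵐ≈1 aᵐ*d≈1)) (*-identityʳ d))

    E≋aI : E ≋ scal a (I 2)
    E≋aI zero zero = sym (*-identityʳ a)
    E≋aI zero one  = trans b≈0 (sym (zeroʳ a))
    E≋aI one  zero = trans c≈0 (sym (zeroʳ a))
    E≋aI one  one  = trans (sym a≈d) (sym (*-identityʳ a))

    scalar : Σ A (λ t → pow t (suc m) ≈ 1# × E ≋ scal t (I 2))
    scalar = a , a*aᵐ≈1 , E≋aI

lemma14 : {c ℓ : Level} (R : CommutativeRing c ℓ) →
          let open CommutativeRing R in let open SymPower R in
          ¬ (1# ≈ 0#) → (n : ℕ) → n ≥ 1 →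
          (E : Mat 2 2) → IsInvertible E →
          (Sym n E ≋ I (suc n)) ⇔ Σ Carrier (λ t → pow t n ≈ 1# × E ≋ scal t (I 2))
lemma14 R _ (suc m) _ E _ =
  mk⇔ (Kernel.scalar R m E) (λ (t , tⁿ≈1 , E≋tI) → scalar⇒kernel R (suc m) E t tⁿ≈1 E≋tI)
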